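{- Let $X$ be a finite set of variables, let $\preccurlyeq$ be a monomial ordering on the monomials in $X$, and let $F\subseteq\mathbb{Z}_2[X]$ be any set of polynomials. Let $\mathcal S_F$ be the set of polynomials that are not residual with respect to $F$, and let $\mathrm{Min}_{\triangleleft}(\mathcal S_F)=\{p\in\mathcal S_F : \text{for all } q\in\mathcal S_F,\ q\triangleleft p \Rightarrow q=p\}$. Then $$|\mathrm{Gb}(F)|=|\mathrm{Min}_{\triangleleft}(\mathcal S_F)|.$$
   Context: $\mathbb{Z}_2$ is the field with two elements. A monomial ordering is a total order $\preccurlyeq$ on monomials with $1\preccurlyeq t$ for all $t$ and $t_1\preccurlyeq t_2\Rightarrow t_1t_3\preccurlyeq t_2t_3$. For a nonzero polynomial $g$, $\mathcal{HT}(g)$ is its highest monomial w.r.t. $\preccurlyeq$. The ordering is extended to polynomials by: $g\preccurlyeq f$ iff $g=f$, or $\mathcal{HT}(g)\prec\mathcal{HT}(f)$, or $\mathcal{HT}(g)=\mathcal{HT}(f)=t$ and $g-t\preccurlyeq f-t$ (recursively; the zero polynomial is below every nonzero polynomial). A polynomial $f$ is residual w.r.t. $F$ if for every $g\in\mathbb{Z}_2[X]$ with $f+g\in\langle F\rangle$ (the ideal generated by $F$) we have $f\preccurlyeq g$. For polynomials $p,q$, $p\triangleleft q$ means there is an injective map $\phi$ from the set of monomials occurring in $p$ to the set of monomials occurring in $q$ such that each monomial $t$ divides $\phi(t)$. $\mathrm{Gb}(F)$ denotes the reduced Gröbner basis of $\langle F\rangle$ w.r.t. $\preccurlyeq$.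 -}

module Defs where

open import Data.Nat using (ℕ; _+_; _∸_; _≤?_)
open import Data.Nat.Properties using (m+[n∸m]≡n; m≤m+n)
open import Data.Bool using (Bool; true; false; _xor_)
open import Data.Vec using (Vec; []; _∷_; zipWith; replicate)
open import Data.Vec.Properties using (≡-dec; ∷-injective)
open import Data.List using (List; []; _∷_; _++_; map; length)
open import Data.List.Membership.Propositional using (_∈_)
open import Data.List.Membership.Propositional.Properties using (∈-++⁺ˡ; ∈-++⁺ʳ; ∈-map⁺)
open import Data.List.Relation.Unary.Any using (Any; here)
open import Data.List.Relation.Unary.All using (All)
open import Data.List.Relation.Unary.AllPairs using (AllPairs)
open import Data.Product using (Σ; _×_; _,_; proj₁; proj₂; ∃)
open import Data.Sum using (_⊎_; inj₁; inj₂)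
open import Data.Empty using (⊥)
open import Relation.Nullary using (Dec; yes; no; ¬_)
open import Relation.Nullary.Decidable using (⌊_⌋)
open import Relation.Binary.PropositionalEquality using (_≡_; refl; cong₂; subst; sym)
open import Function.Bundles using (_⇔_)

-- Monomials in the finite set of variables X = {x_0, …, x_{n-1}}:
-- exponent vectors.

Mon : ℕ → Set
Mon n = Vec ℕ n

one : ∀ {n} → Mon n
one = replicate _ 0

_·_ : ∀ {n} → Mon n → Mon n → Mon n
_·_ = zipWith _+_

_∣ₘ_ : ∀ {n} → Mon n → Mon n → Set
_∣ₘ_ {n} t s = Σ (Mon n) λ u → t · u ≡ s

_≟ₘ_ : ∀ {n} (s t : Mon n) → Dec (s ≡ t)
_≟ₘ_ = ≡-dec Data.Nat._≟_

∣ₘ? : ∀ {n} (t m : Mon n) → Dec (t ∣ₘ m)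
∣ₘ? [] [] = yes ([] , refl)
∣ₘ? (a ∷ t) (b ∷ m) with a ≤? b | ∣ₘ? t m
... | yes a≤b | yes (u , eq) = yes ((b ∸ a) ∷ u , cong₂ _∷_ (m+[n∸m]≡n a≤b) eq)
... | no a≰b | _ = no λ { (c ∷ u , eq) → a≰b (subst (a Data.Nat.≤_) (proj₁ (∷-injective eq)) (m≤m+n a c)) }
... | yes _ | no ¬d = no λ { (c ∷ u , eq) → ¬d (u , proj₂ (∷-injective eq)) }

record MonomialOrder (n : ℕ) : Set₁ where
  field
    _≼_      : Mon n → Mon n → Set
    refl≼    : ∀ {t} → t ≼ t
    antisym≼ : ∀ {s t} → s ≼ t → t ≼ s → s ≡ t
    trans≼   : ∀ {s t u} → s ≼ t → t ≼ u → s ≼ u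
    total≼   : ∀ s t → s ≼ t ⊎ t ≼ s
    one≼     : ∀ t → one ≼ t
    mult≼    : ∀ {t₁ t₂} t₃ → t₁ ≼ t₂ → (t₁ · t₃) ≼ (t₂ · t₃)

-- Polynomials over ℤ₂ in the variables X: a coefficient function
-- Mon n → Bool (= ℤ₂) with finite support.

record Poly (n : ℕ) : Set where
  field
    coeff   : Mon n → Bool
    supp    : List (Mon n)
    supp-ok : ∀ m → coeff m ≡ true → m ∈ supp
open Poly public

_occursIn_ : ∀ {n} → Mon n → Poly n → Set
t occursIn p = coeff p t ≡ true

_≈_ : ∀ {n} → Poly n → Poly n → Set
p ≈ q = ∀ m → coeff p m ≡ coeff q m

0ₚ : ∀ {n} → Poly n
0ₚ = record { coeff = λ _ → false ; supp = [] ; supp-ok = λ _ () }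

private
  xor-true : ∀ x y → (x xor y) ≡ true → x ≡ true ⊎ y ≡ true
  xor-true true  _ _ = inj₁ refl
  xor-true false y e = inj₂ e

-- addition (= subtraction) in ℤ₂[X]
_+ₚ_ : ∀ {n} → Poly n → Poly n → Poly n
p +ₚ q = record
  { coeff = λ m → coeff p m xor coeff q m
  ; supp = supp p ++ supp q
  ; supp-ok = λ m h → ok m (xor-true (coeff p m) (coeff q m) h) }
  where
  ok : ∀ m → coeff p m ≡ true ⊎ coeff q m ≡ true → m ∈ supp p ++ supp q
  ok m (inj₁ h) = ∈-++⁺ˡ (supp-ok p m h)
  ok m (inj₂ h) = ∈-++⁺ʳ (supp p) (supp-ok q m h)

mono : ∀ {n} → Mon n → Poly n
mono t = record
  { coeff = λ m → ⌊ m ≟ₘ t ⌋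
  ; supp = t ∷ []
  ; supp-ok = λ m h → ok m (m ≟ₘ t) h }
  where
  ok : ∀ m (d : Dec (m ≡ t)) → ⌊ d ⌋ ≡ true → m ∈ t ∷ []
  ok m (yes e) _ = here e
  ok m (no _) ()

_*ₘ_ : ∀ {n} → Mon n → Poly n → Poly n
_*ₘ_ {n} t f = record
  { coeff = λ m → c m (∣ₘ? t m)
  ; supp = map (t ·_) (supp f)
  ; supp-ok = λ m → ok m (∣ₘ? t m) }
  where
  c : ∀ m → Dec (t ∣ₘ m) → Bool
  c m (yes (u , _)) = coeff f u
  c m (no _) = false
  ok : ∀ m (d : Dec (t ∣ₘ m)) → c m d ≡ true → m ∈ map (t ·_) (supp f)
  ok m (yes (u , eq)) h = subst (_∈ map (t ·_) (supp f)) eq (∈-map⁺ (t ·_) (supp-ok f u h))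
  ok m (no _) ()

-- Over ℤ₂ every polynomial is a sum of monomials, so ⟨F⟩ is the least
-- set containing 0 and F, closed under +, under multiplication by
-- monomials, and under polynomial equality.

data ⟨_⟩ {n} (F : Poly n → Set) : Poly n → Set where
  gen  : ∀ {f} → F f → ⟨ F ⟩ f
  zer  : ⟨ F ⟩ 0ₚ
  add  : ∀ {f g} → ⟨ F ⟩ f → ⟨ F ⟩ g → ⟨ F ⟩ (f +ₚ g)
  mul  : ∀ t {f} → ⟨ F ⟩ f → ⟨ F ⟩ (t *ₘ f)
  resp : ∀ {f g} → f ≈ g → ⟨ F ⟩ f → ⟨ F ⟩ g

module _ {n : ℕ} (O : MonomialOrder n) where
  open MonomialOrder O

  _≺_ : Mon n → Mon n → Set
  s ≺ t = s ≼ t × ¬ (s ≡ t)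

  IsHT : Poly n → Mon n → Set
  IsHT g t = t occursIn g × (∀ s → s occursIn g → s ≼ t)

  NonZero : Poly n → Set
  NonZero g = Σ (Mon n) λ t → t occursIn g

  data _⊑_ (g f : Poly n) : Set where
    ⊑-eq   : g ≈ f → g ⊑ f
    ⊑-zero : g ≈ 0ₚ → NonZero f → g ⊑ f
    ⊑-lt   : ∀ {s t} → IsHT g s → IsHT f t → s ≺ t → g ⊑ f
    ⊑-rec  : ∀ {t} → IsHT g t → IsHT f t → (g +ₚ mono t) ⊑ (f +ₚ mono t) → g ⊑ f

  Residual : (Poly n → Set) → Poly n → Set
  Residual F f = ∀ g → ⟨ F ⟩ (f +ₚ g) → _⊑_ f g

  𝒮 : (Poly n → Set) → Poly n → Set
  𝒮 F f = ¬ Residual F f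

  -- G is the reduced Gröbner basis of ⟨F⟩ (G a duplicate-free list):
  --  * G ⊆ ⟨F⟩ and every g ∈ G is nonzero,
  --  * (Gröbner) every nonzero f ∈ ⟨F⟩ has HT(f) divisible by HT(g) for some g ∈ G,
  --  * (reduced) no monomial of g ∈ G is divisible by HT(g') for g' ∈ G, g' ≠ g
  --    (coefficients in ℤ₂ are automatically 1, i.e. monic).
  record IsReducedGB (F : Poly n → Set) (G : List (Poly n)) : Set where
    field
      distinct : AllPairs (λ g g' → ¬ (g ≈ g')) G
      inIdeal  : All (⟨ F ⟩) G
      nonzero  : All NonZero G
      groebner : ∀ f t → ⟨ F ⟩ f → IsHT f t →
                 Any (λ g → Σ (Mon n) λ s → IsHT g s × (s ∣ₘ t)) G
      reduced  : ∀ {g g'} → g ∈ G → g' ∈ G → ¬ (g ≈ g') →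
                 ∀ {s} → IsHT g' s → ∀ t → t occursIn g → ¬ (s ∣ₘ t)

_◁_ : ∀ {n} → Poly n → Poly n → Set
_◁_ {n} p q = Σ ((t : Mon n) → t occursIn p → Mon n) λ φ →
    (∀ t h → φ t h occursIn q)
  × (∀ t h → t ∣ₘ φ t h)
  × (∀ t h t' h' → φ t h ≡ φ t' h' → t ≡ t')

Min◁ : ∀ {n} → (Poly n → Set) → Poly n → Set
Min◁ S p = S p × (∀ q → S q → q ◁ p → q ≈ p)

HasCard : ∀ {n} → (Poly n → Set) → ℕ → Set
HasCard {n} P k = Σ (List (Poly n)) λ L →
    AllPairs (λ p q → ¬ (p ≈ q)) L
  × (∀ p → P p ⇔ Any (p ≈_) L)
  × length L ≡ k

{-# OPTIONS --safe #-}
-- A polynomial p none of whose monomials is divisible by a head term of Gb(F) is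
-- residual: if p + g ∈ ⟨F⟩ and HT(g) ≺ HT(p), then HT(p) is the head term of the
-- nonzero ideal element p + g, hence divisible by a head term of Gb(F); so HT(p) ≼ HT(g),
-- and when they agree one strips the common head term and recurses.  Hence every
-- non-residual polynomial contains a multiple of some HT(g), g ∈ Gb(F), while HT(g)
-- itself is non-residual, since it differs from g ∈ ⟨F⟩ only by smaller monomials.
-- So the ◁-minimal non-residual polynomials are exactly the monomials HT(g), and these
-- are pairwise distinct because Gb(F) is reduced.
module Submission where

open import Defs
open import Data.Nat using (ℕ; suc; _≤_; _<_)
open import Data.Nat.Properties using (+-assoc; +-identityʳ; ≤-antisym; m≤m+n)
open import Data.Nat.Induction using (<-wellFounded)
open import Data.Bool using (true; false; _xor_) renaming (_≟_ to _≟ᵇ_)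
open import Data.Bool.Properties using (xor-identityʳ; xor-comm; xor-annihilates-not; ¬-not; not-¬)
open import Data.Vec using ([]; _∷_)
open import Data.Vec.Properties using (zipWith-assoc; zipWith-identityʳ; ∷-injectiveˡ; ∷-injectiveʳ)
open import Data.List using (List; []; _∷_; length; map; filter)
open import Data.List.Properties using (length-map; filter-notAll)
open import Data.List.Membership.Propositional using (_∈_; find; lose)
open import Data.List.Membership.Propositional.Properties using (∈-filter⁺)
open import Data.List.Relation.Unary.Any using (Any; here; there; any?)
import Data.List.Relation.Unary.Any as Any
open import Data.List.Relation.Unary.Any.Properties using (map⁺; map⁻)
open import Data.List.Relation.Unary.All using (All; []; _∷_; reduce)
import Data.List.Relation.Unary.All as All
open import Data.List.Relation.Unary.AllPairs using (AllPairs; []; _∷_)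
import Data.List.Relation.Unary.AllPairs as AllPairs
import Data.List.Relation.Unary.AllPairs.Properties as AllPairsₚ
open import Data.List.Relation.Unary.Unique.Propositional using (Unique)
open import Data.Product using (Σ; _×_; _,_; proj₁; proj₂)
open import Data.Empty using (⊥-elim)
open import Data.Sum using (_⊎_; inj₁; inj₂; [_,_])
open import Function using (_∘_)
open import Function.Bundles using (_⇔_; mk⇔; Equivalence)
open import Induction.WellFounded using (Acc; acc)
open import Relation.Binary.PropositionalEquality
  using (_≡_; _≢_; refl; sym; trans; cong; cong₂; subst)
open import Relation.Nullary using (Dec; yes; no; ¬_; contradiction)
open import Relation.Nullary.Decidable using (_×-dec_; ¬?)
open import Relation.Unary using (Decidable)

module _ {A B : Set} {R : A → B → Set} where

  ∈-reduce⁻ : ∀ {xs} (rs : All (λ x → Σ B (R x)) xs) {b} →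
              b ∈ reduce proj₁ rs → Σ A λ x → x ∈ xs × R x b
  ∈-reduce⁻ ((_ , r) ∷ rs) (here refl) = _ , here refl , r
  ∈-reduce⁻ (_ ∷ rs) (there b∈) with x , x∈xs , r ← ∈-reduce⁻ rs b∈ = x , there x∈xs , r

  ∈-reduce⁺ : (∀ {x b c} → R x b → R x c → b ≡ c) →
              ∀ {xs} (rs : All (λ x → Σ B (R x)) xs) {x b} →
              x ∈ xs → R x b → b ∈ reduce proj₁ rs
  ∈-reduce⁺ functional ((_ , r) ∷ rs) (here refl) rb = here (functional rb r)
  ∈-reduce⁺ functional (_ ∷ rs) (there x∈xs) rb = there (∈-reduce⁺ functional rs x∈xs rb)

  length-reduce : ∀ {xs} (rs : All (λ x → Σ B (R x)) xs) → length (reduce proj₁ rs) ≡ length xs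
  length-reduce [] = refl
  length-reduce (_ ∷ rs) = cong suc (length-reduce rs)

  All-reduce : ∀ {Q : B → Set} {xs} (rs : All (λ x → Σ B (R x)) xs) →
               All (λ x → ∀ {b} → R x b → Q b) xs → All Q (reduce proj₁ rs)
  All-reduce [] [] = []
  All-reduce ((_ , r) ∷ rs) (q ∷ qs) = q r ∷ All-reduce rs qs

  AllPairs-reduce : ∀ {S : B → B → Set} {xs} (rs : All (λ x → Σ B (R x)) xs) →
                    AllPairs (λ x y → ∀ {b c} → R x b → R y c → S b c) xs →
                    AllPairs S (reduce proj₁ rs)
  AllPairs-reduce [] [] = []
  AllPairs-reduce ((_ , r) ∷ rs) (s ∷ ss) =
    All-reduce rs (All.map (λ f {c} → f r) s) ∷ AllPairs-reduce rs ss

AllPairs-map∈ : ∀ {A : Set} {R S : A → A → Set} {xs : List A} →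
                (∀ {x y} → x ∈ xs → y ∈ xs → R x y → S x y) → AllPairs R xs → AllPairs S xs
AllPairs-map∈ f [] = []
AllPairs-map∈ f (r ∷ rs) =
  All.tabulate (λ y∈xs → f (here refl) (there y∈xs) (All.lookup r y∈xs))
  ∷ AllPairs-map∈ (λ x∈xs y∈xs → f (there x∈xs) (there y∈xs)) rs

xor-cancelʳ : ∀ a b c → (a xor c) xor (b xor c) ≡ a xor b
xor-cancelʳ a b false = cong₂ _xor_ (xor-identityʳ a) (xor-identityʳ b)
xor-cancelʳ a b true =
  trans (cong₂ _xor_ (xor-comm a true) (xor-comm b true)) (xor-annihilates-not a b)

module _ {n : ℕ} where

  ·-identityʳ : (s : Mon n) → s · one ≡ s
  ·-identityʳ = zipWith-identityʳ +-identityʳ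

  ·-assoc : (s t u : Mon n) → (s · t) · u ≡ s · (t · u)
  ·-assoc = zipWith-assoc +-assoc

  ∣ₘ-refl : (s : Mon n) → s ∣ₘ s
  ∣ₘ-refl s = one , ·-identityʳ s

  ∣ₘ-trans : {s t u : Mon n} → s ∣ₘ t → t ∣ₘ u → s ∣ₘ u
  ∣ₘ-trans {s} (a , refl) (b , refl) = a · b , sym (·-assoc s a b)

∣ₘ-antisym : ∀ {n} {s t : Mon n} → s ∣ₘ t → t ∣ₘ s → s ≡ t
∣ₘ-antisym {s = []} {[]} _ _ = refl
∣ₘ-antisym {s = x ∷ s} {y ∷ t} (a ∷ u , e) (b ∷ v , e′) =
  cong₂ _∷_ (≤-antisym (subst (x ≤_) (∷-injectiveˡ e) (m≤m+n x a))
                       (subst (y ≤_) (∷-injectiveˡ e′) (m≤m+n y b)))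
            (∣ₘ-antisym (u , ∷-injectiveʳ e) (v , ∷-injectiveʳ e′))

_avoids_ : ∀ {n} → Poly n → (Mon n → Set) → Set
p avoids D = ∀ t → t occursIn p → ¬ D t

module _ {n : ℕ} where

  occurs? : (t : Mon n) (p : Poly n) → Dec (t occursIn p)
  occurs? t p = coeff p t ≟ᵇ true

  ¬occurs⇒≈0 : {p : Poly n} → (∀ m → ¬ m occursIn p) → p ≈ 0ₚ
  ¬occurs⇒≈0 none m = ¬-not (none m)

  ≈0⇒¬occurs : {p : Poly n} → p ≈ 0ₚ → ∀ m → ¬ m occursIn p
  ≈0⇒¬occurs p≈0 m m∈p = not-¬ m∈p (p≈0 m)

  occurs-+ₚ : ∀ {m} (p q : Poly n) → m occursIn (p +ₚ q) → m occursIn p ⊎ m occursIn q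
  occurs-+ₚ {m} p q m∈p+q with coeff p m
  ... | true = inj₁ refl
  ... | false = inj₂ m∈p+q

  +ₚ-congʳ : {p p′ : Poly n} (q : Poly n) → p ≈ p′ → (p +ₚ q) ≈ (p′ +ₚ q)
  +ₚ-congʳ q p≈p′ m = cong (_xor coeff q m) (p≈p′ m)

  +ₚ-cancelʳ : (p q r : Poly n) → ((p +ₚ r) +ₚ (q +ₚ r)) ≈ (p +ₚ q)
  +ₚ-cancelʳ p q r m = xor-cancelʳ (coeff p m) (coeff q m) (coeff r m)

  occurs-mono⇒≡ : {m t : Mon n} → m occursIn mono t → m ≡ t
  occurs-mono⇒≡ {m} {t} m∈t with m ≟ₘ t
  ... | yes m≡t = m≡t

  occurs-mono : (t : Mon n) → t occursIn mono t
  occurs-mono t with t ≟ₘ t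
  ... | yes _ = refl
  ... | no t≢t = contradiction refl t≢t

  mono-injective : {s t : Mon n} → mono s ≈ mono t → s ≡ t
  mono-injective {s} s≈t = occurs-mono⇒≡ (trans (sym (s≈t s)) (occurs-mono s))

  sole-monomial⇒≈mono : {q : Poly n} {t : Mon n} →
                        t occursIn q → (∀ m → m occursIn q → m ≡ t) → q ≈ mono t
  sole-monomial⇒≈mono {q} {t} t∈q sole m with m ≟ₘ t
  ... | yes refl = t∈q
  ... | no m≢t = ¬-not (m≢t ∘ sole m)

  occurs-+mono : {p : Poly n} {t m : Mon n} →
                 t occursIn p → m occursIn (p +ₚ mono t) → m occursIn p × m ≢ t
  occurs-+mono {p} {t} {m} t∈p m∈p+t with m ≟ₘ t
  ... | yes refl with () ← trans (cong (_xor true) (sym t∈p)) m∈p+t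
  ... | no m≢t = trans (sym (xor-identityʳ _)) m∈p+t , m≢t

  ∣-◁-mono : {p : Poly n} {s t : Mon n} → t occursIn p → s ∣ₘ t → mono s ◁ p
  ∣-◁-mono {t = t} t∈p s∣t =
    (λ _ _ → t) , (λ _ _ → t∈p) , (λ m m∈s → subst (_∣ₘ t) (sym (occurs-mono⇒≡ m∈s)) s∣t) ,
    λ m m∈s m′ m′∈s _ → trans (occurs-mono⇒≡ m∈s) (sym (occurs-mono⇒≡ m′∈s))

  ◁-mono⇒∣ : {q : Poly n} {s t : Mon n} → q ◁ mono s → t occursIn q → t ∣ₘ s
  ◁-mono⇒∣ {t = t} (φ , φ∈s , t∣φ , _) t∈q = subst (t ∣ₘ_) (occurs-mono⇒≡ (φ∈s t t∈q)) (t∣φ t t∈q)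

  ◁-mono⇒≈mono : {q : Poly n} {s t : Mon n} → q ◁ mono s → t occursIn q → q ≈ mono t
  ◁-mono⇒≈mono {q} {t = t} (φ , φ∈s , _ , φ-injective) t∈q =
    sole-monomial⇒≈mono {q = q} t∈q λ m m∈q →
      φ-injective m m∈q t t∈q (trans (occurs-mono⇒≡ (φ∈s m m∈q)) (sym (occurs-mono⇒≡ (φ∈s t t∈q))))

  ◁-respʳ : {q p p′ : Poly n} → q ◁ p → p ≈ p′ → q ◁ p′
  ◁-respʳ (φ , φ∈p , t∣φ , φ-injective) p≈p′ =
    φ , (λ t t∈q → trans (sym (p≈p′ _)) (φ∈p t t∈q)) , t∣φ , φ-injective

  Min◁-resp : {S : Poly n → Set} → (∀ {p p′} → p ≈ p′ → S p → S p′) →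
              ∀ {p p′} → p ≈ p′ → Min◁ S p → Min◁ S p′
  Min◁-resp S-resp {p} {p′} p≈p′ (p∈S , p-minimal) =
    S-resp p≈p′ p∈S ,
    λ q q∈S q◁p′ m → trans (p-minimal q q∈S (◁-respʳ {q = q} {p = p′} {p′ = p} q◁p′ λ m → sym (p≈p′ m)) m) (p≈p′ m)

module _ {n : ℕ} (O : MonomialOrder n) where
  open MonomialOrder O

  private
    _≺ₒ_ : Mon n → Mon n → Set
    _≺ₒ_ = _≺_ O

    _⊑ₒ_ : Poly n → Poly n → Set
    _⊑ₒ_ = _⊑_ O

    HT : Poly n → Mon n → Set
    HT = IsHT O

  ≼-≺-trans : ∀ {s t u} → s ≼ t → t ≺ₒ u → s ≺ₒ u
  ≼-≺-trans s≼t (t≼u , t≢u) = trans≼ s≼t t≼u , λ { refl → t≢u (antisym≼ t≼u s≼t) }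

  ≺-trichotomy : ∀ s t → s ≺ₒ t ⊎ s ≡ t ⊎ t ≺ₒ s
  ≺-trichotomy s t with s ≟ₘ t | total≼ s t
  ... | yes s≡t | _ = inj₂ (inj₁ s≡t)
  ... | no s≢t | inj₁ s≼t = inj₁ (s≼t , s≢t)
  ... | no s≢t | inj₂ t≼s = inj₂ (inj₂ (t≼s , s≢t ∘ sym))

  HT-unique : ∀ {p s t} → HT p s → HT p t → s ≡ t
  HT-unique (s∈p , below-s) (t∈p , below-t) = antisym≼ (below-t _ s∈p) (below-s _ t∈p)

  HT-resp : ∀ {p q s} → p ≈ q → HT p s → HT q s
  HT-resp p≈q (s∈p , below) = trans (sym (p≈q _)) s∈p , λ m m∈q → below m (trans (p≈q m) m∈q)

  HT-+ₚ : ∀ {p q a} → HT p a → (∀ m → m occursIn q → m ≺ₒ a) → HT (p +ₚ q) a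
  HT-+ₚ {p} {q} {a} (a∈p , below) q≺a =
    cong₂ _xor_ a∈p (¬-not λ a∈q → proj₂ (q≺a a a∈q) refl) ,
    λ m m∈p+q → [ below m , proj₁ ∘ q≺a m ] (occurs-+ₚ p q m∈p+q)

  max-occurring : (p : Poly n) (L : List (Mon n)) →
                  All (λ m → ¬ m occursIn p) L ⊎
                  Σ (Mon n) λ t → t occursIn p × All (λ m → m occursIn p → m ≼ t) L
  max-occurring p [] = inj₁ []
  max-occurring p (m ∷ L) with max-occurring p L | occurs? m p
  ... | inj₁ none | no m∉p = inj₁ (m∉p ∷ none)
  ... | inj₁ none | yes m∈p =
    inj₂ (m , m∈p , (λ _ → refl≼ {m}) ∷ All.map (λ m′∉p m′∈p → contradiction m′∈p m′∉p) none)
  ... | inj₂ (t , t∈p , below) | no m∉p = inj₂ (t , t∈p , (λ m∈p → contradiction m∈p m∉p) ∷ below)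
  ... | inj₂ (t , t∈p , below) | yes m∈p with total≼ m t
  ...   | inj₁ m≼t = inj₂ (t , t∈p , (λ _ → m≼t) ∷ below)
  ...   | inj₂ t≼m =
    inj₂ (m , m∈p , (λ _ → refl≼ {m}) ∷ All.map (λ m′≼t m′∈p → trans≼ (m′≼t m′∈p) t≼m) below)

  ≈0-or-HT : (p : Poly n) → p ≈ 0ₚ ⊎ Σ (Mon n) (HT p)
  ≈0-or-HT p with max-occurring p (supp p)
  ... | inj₁ none = inj₁ (¬occurs⇒≈0 {p = p} λ m m∈p → All.lookup none (supp-ok p m m∈p) m∈p)
  ... | inj₂ (t , t∈p , below) = inj₂ (t , t∈p , λ m m∈p → All.lookup below (supp-ok p m m∈p) m∈p)

  HT-of-nonzero : ∀ {p} → NonZero O p → Σ (Mon n) (HT p)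
  HT-of-nonzero {p} (m , m∈p) with ≈0-or-HT p
  ... | inj₁ p≈0 = contradiction m∈p (≈0⇒¬occurs {p = p} p≈0 m)
  ... | inj₂ head = head

  ⊑-respˡ : ∀ {p p′ g} → p ≈ p′ → p ⊑ₒ g → p′ ⊑ₒ g
  ⊑-respˡ p≈p′ (⊑-eq p≈g) = ⊑-eq λ m → trans (sym (p≈p′ m)) (p≈g m)
  ⊑-respˡ p≈p′ (⊑-zero p≈0 g≠0) = ⊑-zero (λ m → trans (sym (p≈p′ m)) (p≈0 m)) g≠0
  ⊑-respˡ {p} {p′} p≈p′ (⊑-lt hp hg s≺t) = ⊑-lt (HT-resp {p} {p′} p≈p′ hp) hg s≺t
  ⊑-respˡ {p} {p′} p≈p′ (⊑-rec {t} hp hg rest) =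
    ⊑-rec (HT-resp {p} {p′} p≈p′ hp) hg (⊑-respˡ (+ₚ-congʳ {p = p} {p′ = p′} (mono t) p≈p′) rest)

  𝒮-resp : ∀ {F p p′} → p ≈ p′ → 𝒮 O F p → 𝒮 O F p′
  𝒮-resp {p = p} {p′} p≈p′ p∈𝒮 p′-residual =
    p∈𝒮 λ g p+g∈F →
      ⊑-respˡ (λ m → sym (p≈p′ m)) (p′-residual g (resp (+ₚ-congʳ {p = p} {p′ = p′} g p≈p′) p+g∈F))

  mono⋢below : ∀ {s h} → (∀ m → m occursIn h → m ≺ₒ s) → ¬ (mono s ⊑ₒ h)
  mono⋢below {s} h≺s (⊑-eq s≈h) = proj₂ (h≺s s (trans (sym (s≈h s)) (occurs-mono s))) refl
  mono⋢below {s} h≺s (⊑-zero s≈0 _) = ≈0⇒¬occurs {p = mono s} s≈0 s (occurs-mono s)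
  mono⋢below h≺s (⊑-lt (u∈s , _) (t∈h , _) (u≼t , u≢t)) with refl ← occurs-mono⇒≡ u∈s =
    u≢t (antisym≼ u≼t (proj₁ (h≺s _ t∈h)))
  mono⋢below h≺s (⊑-rec (t∈s , _) (t∈h , _) _) with refl ← occurs-mono⇒≡ t∈s =
    proj₂ (h≺s _ t∈h) refl

  HT-nonresidual : ∀ {F g s} → ⟨ F ⟩ g → HT g s → 𝒮 O F (mono s)
  HT-nonresidual {g = g} {s} g∈F (s∈g , below) mono-residual =
    mono⋢below g+s≺s (mono-residual (g +ₚ mono s) (resp s+g+s≈g g∈F))
    where
    -- 0ₚ +ₚ mono s has the same coefficients as mono s by computation.
    s+g+s≈g : g ≈ (mono s +ₚ (g +ₚ mono s))
    s+g+s≈g m = sym (+ₚ-cancelʳ 0ₚ g (mono s) m)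

    g+s≺s : ∀ m → m occursIn (g +ₚ mono s) → m ≺ₒ s
    g+s≺s m m∈g+s with m∈g , m≢s ← occurs-+mono {p = g} s∈g m∈g+s = below m m∈g , m≢s

  module _ {F : Poly n → Set} {D : Mon n → Set}
           (ideal-HT∈D : ∀ {f t} → ⟨ F ⟩ f → HT f t → D t) where

    HT-survives : ∀ {p q a} → p avoids D → HT p a → (∀ m → m occursIn q → m ≺ₒ a) → ¬ ⟨ F ⟩ (p +ₚ q)
    HT-survives {p} {q} p-avoids ha q≺a p+q∈F =
      p-avoids _ (proj₁ ha) (ideal-HT∈D p+q∈F (HT-+ₚ {p} {q} ha q≺a))

    avoiding⇒⊑ : (L : List (Mon n)) → Acc _<_ (length L) → ∀ {p} → (∀ m → m occursIn p → m ∈ L) →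
                 p avoids D → ∀ g → ⟨ F ⟩ (p +ₚ g) → p ⊑ₒ g
    avoiding⇒⊑ L (acc smaller) {p} p⊆L p-avoids g p+g∈F with ≈0-or-HT p | ≈0-or-HT g
    ... | inj₁ p≈0 | inj₁ g≈0 = ⊑-eq λ m → trans (p≈0 m) (sym (g≈0 m))
    ... | inj₁ p≈0 | inj₂ (b , b∈g , _) = ⊑-zero p≈0 (b , b∈g)
    ... | inj₂ (a , ha) | inj₁ g≈0 =
      contradiction p+g∈F (HT-survives {p} {g} p-avoids ha λ m → ⊥-elim ∘ ≈0⇒¬occurs {p = g} g≈0 m)
    ... | inj₂ (a , ha) | inj₂ (b , hb) with ≺-trichotomy a b
    ...   | inj₁ a≺b = ⊑-lt ha hb a≺b
    ...   | inj₂ (inj₂ b≺a) =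
      contradiction p+g∈F (HT-survives {p} {g} p-avoids ha λ m m∈g → ≼-≺-trans (proj₂ hb m m∈g) b≺a)
    ...   | inj₂ (inj₁ refl) =
      ⊑-rec ha hb (avoiding⇒⊑ L′ (smaller L′<L) p′⊆L′ p′-avoids (g +ₚ mono a) p′+g′∈F)
      where
      a∈p : a occursIn p
      a∈p = proj₁ ha

      L′ : List (Mon n)
      L′ = filter (λ m → ¬? (m ≟ₘ a)) L

      L′<L : length L′ < length L
      L′<L = filter-notAll (λ m → ¬? (m ≟ₘ a)) L (Any.map (λ { refl a≢a → a≢a refl }) (p⊆L a a∈p))

      p′⊆L′ : ∀ m → m occursIn (p +ₚ mono a) → m ∈ L′
      p′⊆L′ m m∈p′ with m∈p , m≢a ← occurs-+mono {p = p} a∈p m∈p′ =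
        ∈-filter⁺ (λ m → ¬? (m ≟ₘ a)) (p⊆L m m∈p) m≢a

      p′-avoids : (p +ₚ mono a) avoids D
      p′-avoids m m∈p′ = p-avoids m (proj₁ (occurs-+mono {p = p} a∈p m∈p′))

      p′+g′∈F : ⟨ F ⟩ ((p +ₚ mono a) +ₚ (g +ₚ mono a))
      p′+g′∈F = resp (λ m → sym (+ₚ-cancelʳ p g (mono a) m)) p+g∈F

    avoiding⇒residual : ∀ {p} → p avoids D → Residual O F p
    avoiding⇒residual {p} = avoiding⇒⊑ (supp p) (<-wellFounded _) (supp-ok p)

    nonresidual⇒meets : Decidable D → ∀ {p} → 𝒮 O F p → Σ (Mon n) λ t → t occursIn p × D t
    nonresidual⇒meets D? {p} p∈𝒮 with any? (λ t → occurs? t p ×-dec D? t) (supp p)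
    ... | yes meets with t , _ , t∈p , t∈D ← find meets = t , t∈p , t∈D
    ... | no misses =
      contradiction (avoiding⇒residual λ t t∈p t∈D → misses (lose (supp-ok p t t∈p) (t∈p , t∈D)))
                    p∈𝒮

module _ {n : ℕ} {O : MonomialOrder n} {F : Poly n → Set} {G : List (Poly n)}
         (gb : IsReducedGB O F G) where
  open IsReducedGB gb

  private
    heads : All (λ g → Σ (Mon n) (IsHT O g)) G
    heads = All.map (λ {g} → HT-of-nonzero O {g}) nonzero

  headTerms : List (Mon n)
  headTerms = reduce proj₁ heads

  length-headTerms : length headTerms ≡ length G
  length-headTerms = length-reduce heads

  HT∈headTerms : ∀ {g s} → g ∈ G → IsHT O g s → s ∈ headTerms
  HT∈headTerms = ∈-reduce⁺ (λ {g} → HT-unique O {g}) heads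

  ∈headTerms⇒HT : ∀ {s} → s ∈ headTerms → Σ (Poly n) λ g → g ∈ G × IsHT O g s
  ∈headTerms⇒HT = ∈-reduce⁻ heads

  headTerms-unique : Unique headTerms
  headTerms-unique = AllPairs-reduce heads (AllPairs-map∈ distinct-HTs distinct)
    where
    distinct-HTs : ∀ {g g′} → g ∈ G → g′ ∈ G → ¬ (g ≈ g′) →
                   ∀ {s s′} → IsHT O g s → IsHT O g′ s′ → s ≢ s′
    distinct-HTs g∈G g′∈G g≉g′ {s} (s∈g , _) hs′ refl = reduced g∈G g′∈G g≉g′ hs′ s s∈g (∣ₘ-refl s)

  headTerm-∣-headTerm : ∀ {s s′} → s ∈ headTerms → s′ ∈ headTerms → s′ ∣ₘ s → s′ ≡ s
  headTerm-∣-headTerm {s} {s′} s∈H s′∈H s′∣s with s′ ≟ₘ s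
  ... | yes s′≡s = s′≡s
  ... | no s′≢s with g , g∈G , hs ← ∈headTerms⇒HT s∈H | g′ , g′∈G , hs′ ← ∈headTerms⇒HT s′∈H =
    contradiction s′∣s (reduced g∈G g′∈G g≉g′ hs′ s (proj₁ hs))
    where
    g≉g′ : ¬ (g ≈ g′)
    g≉g′ g≈g′ = s′≢s (HT-unique O {g′} hs′ (HT-resp O {g} {g′} g≈g′ hs))

  Divisible : Mon n → Set
  Divisible t = Any (_∣ₘ t) headTerms

  divisible? : Decidable Divisible
  divisible? t = any? (λ s → ∣ₘ? s t) headTerms

  ideal-HT-divisible : ∀ {f t} → ⟨ F ⟩ f → IsHT O f t → Divisible t
  ideal-HT-divisible {f} {t} f∈F ht with g , g∈G , s , hs , s∣t ← find (groebner f t f∈F ht) =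
    lose (HT∈headTerms g∈G hs) s∣t

  nonresidual⇒HT-multiple : ∀ {p} → 𝒮 O F p →
                            Σ (Mon n) λ t → t occursIn p × Σ (Mon n) λ s → s ∈ headTerms × s ∣ₘ t
  nonresidual⇒HT-multiple p∈𝒮
    with t , t∈p , t-divisible ← nonresidual⇒meets O ideal-HT-divisible divisible? p∈𝒮 =
    t , t∈p , find t-divisible

  headTerm-Min◁ : ∀ {s} → s ∈ headTerms → Min◁ (𝒮 O F) (mono s)
  headTerm-Min◁ {s} s∈H with g , g∈G , hs ← ∈headTerms⇒HT s∈H =
    HT-nonresidual O (All.lookup inIdeal g∈G) hs , minimal
    where
    minimal : ∀ q → 𝒮 O F q → q ◁ mono s → q ≈ mono s
    minimal q q∈𝒮 q◁s with t , t∈q , s′ , s′∈H , s′∣t ← nonresidual⇒HT-multiple q∈𝒮 =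
      subst (λ u → q ≈ mono u) t≡s (◁-mono⇒≈mono {q = q} q◁s t∈q)
      where
      t∣s : t ∣ₘ s
      t∣s = ◁-mono⇒∣ {q = q} q◁s t∈q

      t≡s : t ≡ s
      t≡s = ∣ₘ-antisym t∣s (subst (_∣ₘ t) (headTerm-∣-headTerm s∈H s′∈H (∣ₘ-trans s′∣t t∣s)) s′∣t)

  Min◁⇒headTerm : ∀ {p} → Min◁ (𝒮 O F) p → Any (λ s → p ≈ mono s) headTerms
  Min◁⇒headTerm {p} (p∈𝒮 , p-minimal) with t , t∈p , s , s∈H , s∣t ← nonresidual⇒HT-multiple p∈𝒮 =
    lose s∈H λ m → sym (p-minimal (mono s) (proj₁ (headTerm-Min◁ s∈H)) (∣-◁-mono {p = p} t∈p s∣t) m)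

  Min◁⇔headTerm : ∀ p → Min◁ (𝒮 O F) p ⇔ Any (λ s → p ≈ mono s) headTerms
  Min◁⇔headTerm p = mk⇔ Min◁⇒headTerm from
    where
    from : Any (λ s → p ≈ mono s) headTerms → Min◁ (𝒮 O F) p
    from p≈headTerm with s , s∈H , p≈s ← find p≈headTerm =
      Min◁-resp (𝒮-resp O) (λ m → sym (p≈s m)) (headTerm-Min◁ s∈H)

HasCard-monos : ∀ {n} {P : Poly n → Set} {ss : List (Mon n)} →
                Unique ss → (∀ p → P p ⇔ Any (λ s → p ≈ mono s) ss) → HasCard P (length ss)
HasCard-monos {ss = ss} ss-unique P⇔ss =
  map mono ss ,
  AllPairsₚ.map⁺ (AllPairs.map (λ s≢s′ → s≢s′ ∘ mono-injective) ss-unique) ,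
  (λ p → mk⇔ (map⁺ ∘ Equivalence.to (P⇔ss p)) (Equivalence.from (P⇔ss p) ∘ map⁻)) ,
  length-map mono ss

theorem3p3 : (n : ℕ) (O : MonomialOrder n) (F : Poly n → Set) (G : List (Poly n)) →
    IsReducedGB O F G →
    HasCard (Min◁ (𝒮 O F)) (length G)
theorem3p3 n O F G gb =
  subst (HasCard (Min◁ (𝒮 O F))) (length-headTerms gb)
        (HasCard-monos (headTerms-unique gb) (Min◁⇔headTerm gb))
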